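{- Let $w$ be a p-string with $\Pi_w\neq\emptyset$ and let $k=|\Pi_w|+2$. For any integer $p$ with $0<p\le\frac{|w|}{k}$, $p$ is a prefix period of $w$ if and only if $\mathrm{period}(w[0:kp])=p$.
   Context: Let $\Sigma$ and $\Pi$ be disjoint alphabets; a p-string is a string over $\Sigma\cup\Pi$, indexed from 0, with $w[i:j]=w[i]\cdots w[j-1]$. A permutation $f$ of $\Pi$ acts on p-strings letterwise, fixing letters of $\Sigma$; $x\equiv y$ iff $f(x)=y$ for some permutation $f$ of $\Pi$. For $p\in\mathbb{N}^+$, $p\le|w|$, $p$ is a period of $w$ iff $w[0:|w|-p]\equiv w[p:|w|]$; $\mathrm{period}(w)$ is the smallest period of a nonempty $w$. $\Pi_w$ is the set of parameter characters occurring in $w$. With $k=|\Pi_w|+2$, a positive integer $p$ is a prefix period of $w$ iff there is a prefix $w'$ of $w$ with $\mathrm{period}(w')=p$ and $p\le|w'|/k$. -}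

module Defs where

open import Data.Nat using (ℕ; zero; suc; _+_; _*_; _∸_; _≤_; _<_)
open import Data.List using (List; []; _∷_; length; take; drop; map; deduplicate)
open import Data.Sum using (_⊎_; inj₁; inj₂)
open import Data.Product using (Σ; ∃; _×_; _,_)
open import Function.Bundles using (_↔_; Inverse)
open import Relation.Binary.PropositionalEquality using (_≡_)
open import Relation.Binary.Definitions using (DecidableEquality)

-- p-strings over Σ ∪ Π (Σ constant letters, Π parameter letters; disjoint via ⊎)
PString : Set → Set → Set
PString S P = List (S ⊎ P)

actLetter : {S P : Set} → (P ↔ P) → S ⊎ P → S ⊎ P
actLetter f (inj₁ a) = inj₁ a
actLetter f (inj₂ b) = inj₂ (Inverse.to f b)

act : {S P : Set} → (P ↔ P) → PString S P → PString S P
act f = map (actLetter f)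

_≈ₚ_ : {S P : Set} → PString S P → PString S P → Set
x ≈ₚ y = Σ (_ ↔ _) λ f → act f x ≡ y

IsPeriod : {S P : Set} → PString S P → ℕ → Set
IsPeriod w p = (0 < p) × (p ≤ length w) × (take (length w ∸ p) w ≈ₚ drop p w)

PeriodIs : {S P : Set} → PString S P → ℕ → Set
PeriodIs w p = (0 < length w) × IsPeriod w p × (∀ q → IsPeriod w q → p ≤ q)

params : {S P : Set} → PString S P → List P
params [] = []
params (inj₁ _ ∷ w) = params w
params (inj₂ b ∷ w) = b ∷ params w

numParams : {S P : Set} → DecidableEquality P → PString S P → ℕ
numParams _≟_ w = length (deduplicate _≟_ (params w))

-- p is a prefix period of w (k = |Π_w| + 2): some prefix w' = w[0:n]
-- has period(w') = p and p ≤ |w'|/k, i.e. k * p ≤ |w'|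
IsPrefixPeriod : {S P : Set} → DecidableEquality P → PString S P → ℕ → Set
IsPrefixPeriod _≟_ w p =
  Σ ℕ λ n → (n ≤ length w) ×
    PeriodIs (take n w) p × ((numParams _≟_ w + 2) * p ≤ length (take n w))

{-# OPTIONS --safe #-}
module Submission where

-- Let w[0:n] have minimal period p (witnessed by the permutation f), let m = |Π_w|, and let
-- q < p be a period of w[0:(m+2)p] (witnessed by g).  Every parameter letter of w[0:n]
-- already occurs below mp: at an occurrence i ≥ mp, the m+1 positions i − tp (t ≤ m) all
-- carry parameter letters, two of them coincide, and shifting that coincidence up by a
-- multiple of p yields an earlier occurrence of w[i].  At an occurrence j < mp both
-- f(g(w[j])) and g(f(w[j])) equal w[j+p+q], which still lies in w[0:(m+2)p]; so f and g
-- commute on all letters of w[0:n].  Then w[q+i] = f(w[q+i−p]) = f(g(w[i−p])) =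
-- g(f(w[i−p])) = g(w[i]) extends the period q to w[0:n], contradicting minimality of p.

open import Defs
open import Data.Fin using (Fin; toℕ)
import Data.Fin.Properties as Fin
open import Data.List using (List; []; _∷_; take; drop; length; map; lookup; deduplicate)
open import Data.List.Membership.Propositional using (_∈_)
open import Data.List.Membership.Propositional.Properties using (∈-deduplicate⁺)
open import Data.List.Properties using (length-take)
open import Data.List.Relation.Unary.Any using (here; there; index)
open import Data.List.Relation.Unary.Any.Properties using (lookup-index)
open import Data.Maybe using (Maybe; just; nothing)
import Data.Maybe as Maybe
open import Data.Maybe.Properties using (just-injective; map-id; map-∘)
open import Data.Nat using (ℕ; zero; suc; _+_; _*_; _∸_; _≤_; _<_; z≤n; s≤s; _<?_; _≤?_; >-nonZero)
open import Data.Nat.Induction using (<-rec)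
open import Data.Nat.Properties
open import Algebra.Properties.CommutativeSemigroup +-commutativeSemigroup using (x∙yz≈y∙xz)
open import Data.Product using (_×_; Σ; ∃; ∃₂; _,_; proj₁; proj₂)
open import Data.Sum using (_⊎_; inj₁; inj₂)
import Function.Endo.Propositional as Endo
open import Function.Bundles using (_↔_)
open import Relation.Binary.Definitions using (DecidableEquality)
open import Relation.Binary.PropositionalEquality
open import Relation.Nullary using (yes; no; contradiction)

at : {A : Set} → List A → ℕ → Maybe A
at []       _       = nothing
at (x ∷ xs) zero    = just x
at (x ∷ xs) (suc i) = at xs i

at-map : ∀ {A B : Set} (g : A → B) xs i → at (map g xs) i ≡ Maybe.map g (at xs i)
at-map g []       i       = refl
at-map g (x ∷ xs) zero    = refl
at-map g (x ∷ xs) (suc i) = at-map g xs i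

at-drop : ∀ {A : Set} k (xs : List A) i → at (drop k xs) i ≡ at xs (k + i)
at-drop zero    xs       i = refl
at-drop (suc k) []       i = refl
at-drop (suc k) (x ∷ xs) i = at-drop k xs i

at-take : ∀ {A : Set} n (xs : List A) {i} → i < n → at (take n xs) i ≡ at xs i
at-take (suc n) []       _         = refl
at-take (suc n) (x ∷ xs) {zero}  _ = refl
at-take (suc n) (x ∷ xs) {suc i} (s≤s i<n) = at-take n xs i<n

at-take-≥ : ∀ {A : Set} n (xs : List A) {i} → n ≤ i → at (take n xs) i ≡ nothing
at-take-≥ zero    xs       _         = refl
at-take-≥ (suc n) []       _         = refl
at-take-≥ (suc n) (x ∷ xs) (s≤s n≤i) = at-take-≥ n xs n≤i

at-take-∸ : ∀ {A : Set} (xs : List A) k {i} → k + i < length xs → at (take (length xs ∸ k) xs) i ≡ at xs i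
at-take-∸ xs k {i} k+i<len =
  at-take (length xs ∸ k) xs (m+n≤o⇒m≤o∸n (suc i) (subst (_< length xs) (+-comm k i) k+i<len))

at-≥length : ∀ {A : Set} (xs : List A) {i} → length xs ≤ i → at xs i ≡ nothing
at-≥length []       _         = refl
at-≥length (x ∷ xs) (s≤s len≤i) = at-≥length xs len≤i

at-ext : ∀ {A : Set} (xs ys : List A) → (∀ i → at xs i ≡ at ys i) → xs ≡ ys
at-ext []       []       _  = refl
at-ext []       (y ∷ ys) eq with () ← eq 0
at-ext (x ∷ xs) []       eq with () ← eq 0
at-ext (x ∷ xs) (y ∷ ys) eq = cong₂ _∷_ (just-injective (eq 0)) (at-ext xs ys (λ i → eq (suc i)))

length-take-≤ : ∀ {A : Set} n (xs : List A) → n ≤ length xs → length (take n xs) ≡ n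
length-take-≤ n xs n≤ = trans (length-take n xs) (m≤n⇒m⊓n≡m n≤)

at-params : ∀ {S P : Set} (w : PString S P) i {c} → at w i ≡ just (inj₂ c) → c ∈ params w
at-params (inj₂ b ∷ w) zero    refl = here refl
at-params (inj₁ a ∷ w) (suc i) eq   = at-params w i eq
at-params (inj₂ b ∷ w) (suc i) eq   = there (at-params w i eq)

pigeonhole-∈ : {A : Set} (xs : List A) (g : Fin (suc (length xs)) → A) → (∀ j → g j ∈ xs) →
               ∃₂ λ j₁ j₂ → toℕ j₁ < toℕ j₂ × g j₁ ≡ g j₂
pigeonhole-∈ xs g g∈ =
  let j₁ , j₂ , j₁<j₂ , same = Fin.pigeonhole (n<1+n _) (λ j → index (g∈ j))
  in j₁ , j₂ , j₁<j₂ ,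
     trans (lookup-index (g∈ j₁)) (trans (cong (lookup xs) same) (sym (lookup-index (g∈ j₂))))

-- p is a period of w[0:n], witnessed by f; positions past the end of w read as nothing.
Periodic : {S P : Set} → ℕ → PString S P → ℕ → (P ↔ P) → Set
Periodic n w p f = ∀ i → p + i < n → at w (p + i) ≡ Maybe.map (actLetter f) (at w i)

module _ {S P : Set} where

  isPeriod⇒periodic : ∀ (u : PString S P) {q} → IsPeriod u q → Σ (P ↔ P) (Periodic (length u) u q)
  isPeriod⇒periodic u {q} (_ , _ , f , shifted) = f , λ i q+i<len → begin
    at u (q + i)                                       ≡⟨ at-drop q u i ⟨
    at (drop q u) i                                    ≡⟨ cong (λ v → at v i) shifted ⟨
    at (act f (take (length u ∸ q) u)) i               ≡⟨ at-map (actLetter f) (take (length u ∸ q) u) i ⟩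
    Maybe.map (actLetter f) (at (take (length u ∸ q) u) i)
      ≡⟨ cong (Maybe.map (actLetter f)) (at-take-∸ u q q+i<len) ⟩
    Maybe.map (actLetter f) (at u i)                   ∎
    where open ≡-Reasoning

  periodic⇒isPeriod : ∀ (u : PString S P) {q f} → 0 < q → q ≤ length u → Periodic (length u) u q f → IsPeriod u q
  periodic⇒isPeriod u {q} {f} q>0 q≤len per = q>0 , q≤len , f , at-ext _ _ agree
    where
    open ≡-Reasoning
    shifted-prefix : ∀ i → at (act f (take (length u ∸ q) u)) i ≡ Maybe.map (actLetter f) (at (take (length u ∸ q) u) i)
    shifted-prefix = at-map (actLetter f) (take (length u ∸ q) u)
    agree : ∀ i → at (act f (take (length u ∸ q) u)) i ≡ at (drop q u) i
    agree i with q + i <? length u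
    ... | yes q+i<len = begin
      at (act f (take (length u ∸ q) u)) i                   ≡⟨ shifted-prefix i ⟩
      Maybe.map (actLetter f) (at (take (length u ∸ q) u) i)
        ≡⟨ cong (Maybe.map (actLetter f)) (at-take-∸ u q q+i<len) ⟩
      Maybe.map (actLetter f) (at u i)                       ≡⟨ per i q+i<len ⟨
      at u (q + i)                                           ≡⟨ at-drop q u i ⟨
      at (drop q u) i                                        ∎
    ... | no q+i≮len = begin
      at (act f (take (length u ∸ q) u)) i                   ≡⟨ shifted-prefix i ⟩
      Maybe.map (actLetter f) (at (take (length u ∸ q) u) i)
        ≡⟨ cong (Maybe.map (actLetter f)) (at-take-≥ _ u (m≤n+o⇒m∸n≤o (length u) q (≮⇒≥ q+i≮len))) ⟩
      nothing                                                ≡⟨ at-≥length u (≮⇒≥ q+i≮len) ⟨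
      at u (q + i)                                           ≡⟨ at-drop q u i ⟨
      at (drop q u) i                                        ∎

  periodic-take⁺ : ∀ {n} {w : PString S P} {q f} → Periodic n w q f → Periodic n (take n w) q f
  periodic-take⁺ {n} {w} {q} {f} per i q+i<n = begin
    at (take n w) (q + i)                     ≡⟨ at-take n w q+i<n ⟩
    at w (q + i)                              ≡⟨ per i q+i<n ⟩
    Maybe.map (actLetter f) (at w i)          ≡⟨ cong (Maybe.map (actLetter f)) (at-take n w (≤-<-trans (m≤n+m i q) q+i<n)) ⟨
    Maybe.map (actLetter f) (at (take n w) i) ∎
    where open ≡-Reasoning

  periodic-take⁻ : ∀ {n} {w : PString S P} {q f} → Periodic n (take n w) q f → Periodic n w q f
  periodic-take⁻ {n} {w} {q} {f} per i q+i<n = begin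
    at w (q + i)                              ≡⟨ at-take n w q+i<n ⟨
    at (take n w) (q + i)                     ≡⟨ per i q+i<n ⟩
    Maybe.map (actLetter f) (at (take n w) i) ≡⟨ cong (Maybe.map (actLetter f)) (at-take n w (≤-<-trans (m≤n+m i q) q+i<n)) ⟩
    Maybe.map (actLetter f) (at w i)          ∎
    where open ≡-Reasoning

  isPeriod-take⇒periodic : ∀ {n} {w : PString S P} {q} → n ≤ length w →
                           IsPeriod (take n w) q → Σ (P ↔ P) (Periodic n w q)
  isPeriod-take⇒periodic {n} {w} n≤len isP
    with f , per ← isPeriod⇒periodic (take n w) isP
    rewrite length-take-≤ n w n≤len = f , periodic-take⁻ per

  periodic⇒isPeriod-take : ∀ {n} {w : PString S P} {q f} → n ≤ length w → 0 < q → q ≤ n →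
                           Periodic n w q f → IsPeriod (take n w) q
  periodic⇒isPeriod-take {n} {w} n≤len q>0 q≤n per =
    periodic⇒isPeriod (take n w) q>0 q≤len (subst (λ l → Periodic l (take n w) _ _) (sym len≡) (periodic-take⁺ per))
    where
    len≡ : length (take n w) ≡ n
    len≡ = length-take-≤ n w n≤len
    q≤len : _ ≤ length (take n w)
    q≤len = subst (_ ≤_) (sym len≡) q≤n

module _ {S P : Set} where
  open Endo (S ⊎ P) using (_^_)

  actLetter^-inj₁ : ∀ (f : P ↔ P) r a → (actLetter f ^ r) (inj₁ a) ≡ inj₁ a
  actLetter^-inj₁ f zero    a = refl
  actLetter^-inj₁ f (suc r) a = cong (actLetter f) (actLetter^-inj₁ f r a)

  map-actLetter^-inj₂⁻ : ∀ (f : P ↔ P) r (x : Maybe (S ⊎ P)) {c} →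
                         Maybe.map (actLetter f ^ r) x ≡ just (inj₂ c) → ∃ λ c′ → x ≡ just (inj₂ c′)
  map-actLetter^-inj₂⁻ f r (just (inj₁ a)) eq
    with () ← trans (cong just (sym (actLetter^-inj₁ f r a))) eq
  map-actLetter^-inj₂⁻ f r (just (inj₂ b)) _ = b , refl

  periodic-iterate : ∀ {n} (w : PString S P) {p} (f : P ↔ P) → Periodic n w p f →
                     ∀ r x → r * p + x < n → at w (r * p + x) ≡ Maybe.map (actLetter f ^ r) (at w x)
  periodic-iterate w f per zero x _ = sym (map-id (at w x))
  periodic-iterate {n} w {p} f per (suc r) x [p+rp]+x<n = begin
    at w ((p + r * p) + x)                                         ≡⟨ cong (at w) (+-assoc p (r * p) x) ⟩
    at w (p + (r * p + x))                                         ≡⟨ per (r * p + x) p+[rp+x]<n ⟩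
    Maybe.map (actLetter f) (at w (r * p + x))                     ≡⟨ cong (Maybe.map (actLetter f)) iterated ⟩
    Maybe.map (actLetter f) (Maybe.map (actLetter f ^ r) (at w x)) ≡⟨ map-∘ (at w x) ⟨
    Maybe.map (actLetter f ^ suc r) (at w x)                       ∎
    where
    open ≡-Reasoning
    p+[rp+x]<n : p + (r * p + x) < n
    p+[rp+x]<n = subst (_< n) (+-assoc p (r * p) x) [p+rp]+x<n
    iterated : at w (r * p + x) ≡ Maybe.map (actLetter f ^ r) (at w x)
    iterated = periodic-iterate w f per r x (≤-<-trans (m≤n+m (r * p + x) p) p+[rp+x]<n)

module _ {S P : Set} (_≟_ : DecidableEquality P) {w : PString S P} {n p : ℕ} {f : P ↔ P}
         (per : Periodic n w p f) where
  open Endo (S ⊎ P) using (_^_)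

  private
    m : ℕ
    m = numParams _≟_ w

  earlier-occurrence : 0 < p → ∀ {i c} → m * p ≤ i → i < n → at w i ≡ just (inj₂ c) →
                       ∃ λ i′ → i′ < i × at w i′ ≡ just (inj₂ c)
  earlier-occurrence p>0 {i} {c} mp≤i i<n wᵢ≡c =
    let s , t , s<t , same = pigeonhole-∈ (deduplicate _≟_ (params w)) letter letter∈
    in (m ∸ toℕ t) * p + pos (toℕ s) , lifted-< s<t , lifted-≡ s<t same
    where
    open ≡-Reasoning
    b : ℕ
    b = i ∸ m * p
    pos : ℕ → ℕ
    pos t = t * p + b
    lift : ∀ t → t ≤ m → (m ∸ t) * p + pos t ≡ i
    lift t t≤m = begin
      (m ∸ t) * p + (t * p + b) ≡⟨ +-assoc ((m ∸ t) * p) (t * p) b ⟨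
      ((m ∸ t) * p + t * p) + b ≡⟨ cong (_+ b) (*-distribʳ-+ p (m ∸ t) t) ⟨
      ((m ∸ t) + t) * p + b     ≡⟨ cong (λ k → k * p + b) (m∸n+n≡m t≤m) ⟩
      m * p + b                 ≡⟨ m+[n∸m]≡n mp≤i ⟩
      i                         ∎
    lift-Fin : (t : Fin (suc m)) → (m ∸ toℕ t) * p + pos (toℕ t) ≡ i
    lift-Fin t = lift (toℕ t) (Fin.toℕ≤pred[n] t)
    lift-< : (t : Fin (suc m)) → (m ∸ toℕ t) * p + pos (toℕ t) < n
    lift-< t = subst (_< n) (sym (lift-Fin t)) i<n
    parameter-at : (t : Fin (suc m)) → ∃ λ c′ → at w (pos (toℕ t)) ≡ just (inj₂ c′)
    parameter-at t = map-actLetter^-inj₂⁻ f (m ∸ toℕ t) (at w (pos (toℕ t)))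
      (trans (sym (periodic-iterate w f per (m ∸ toℕ t) (pos (toℕ t)) (lift-< t))) (trans (cong (at w) (lift-Fin t)) wᵢ≡c))
    letter : Fin (suc m) → P
    letter t = proj₁ (parameter-at t)
    letter∈ : ∀ t → letter t ∈ deduplicate _≟_ (params w)
    letter∈ t = ∈-deduplicate⁺ _≟_ (at-params w (pos (toℕ t)) (proj₂ (parameter-at t)))
    lifted-< : ∀ {s t : Fin (suc m)} → toℕ s < toℕ t → (m ∸ toℕ t) * p + pos (toℕ s) < i
    lifted-< {s} {t} s<t = subst ((m ∸ toℕ t) * p + pos (toℕ s) <_) (lift-Fin t)
      (+-monoʳ-< ((m ∸ toℕ t) * p) (+-monoˡ-< b (*-monoˡ-< p {{>-nonZero p>0}} s<t)))
    lifted-≡ : ∀ {s t : Fin (suc m)} → toℕ s < toℕ t → letter s ≡ letter t →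
               at w ((m ∸ toℕ t) * p + pos (toℕ s)) ≡ just (inj₂ c)
    lifted-≡ {s} {t} s<t same = begin
      at w ((m ∸ toℕ t) * p + pos (toℕ s))
        ≡⟨ periodic-iterate w f per (m ∸ toℕ t) (pos (toℕ s)) (<-trans (lifted-< s<t) i<n) ⟩
      Maybe.map (actLetter f ^ (m ∸ toℕ t)) (at w (pos (toℕ s)))
        ≡⟨ cong (Maybe.map (actLetter f ^ (m ∸ toℕ t))) same-position ⟩
      Maybe.map (actLetter f ^ (m ∸ toℕ t)) (at w (pos (toℕ t)))
        ≡⟨ periodic-iterate w f per (m ∸ toℕ t) (pos (toℕ t)) (lift-< t) ⟨
      at w ((m ∸ toℕ t) * p + pos (toℕ t))
        ≡⟨ cong (at w) (lift-Fin t) ⟩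
      at w i
        ≡⟨ wᵢ≡c ⟩
      just (inj₂ c) ∎
      where
      same-position : at w (pos (toℕ s)) ≡ at w (pos (toℕ t))
      same-position = trans (proj₂ (parameter-at s))
        (trans (cong (λ d → just (inj₂ d)) same) (sym (proj₂ (parameter-at t))))

  occurs-below : 0 < p → ∀ i {c} → i < n → at w i ≡ just (inj₂ c) →
                 ∃ λ i′ → i′ < m * p × at w i′ ≡ just (inj₂ c)
  occurs-below p>0 = <-rec Occurs step
    where
    Occurs : ℕ → Set
    Occurs i = ∀ {c} → i < n → at w i ≡ just (inj₂ c) → ∃ λ i′ → i′ < m * p × at w i′ ≡ just (inj₂ c)
    step : ∀ i → (∀ {j} → j < i → Occurs j) → Occurs i
    step i earlier i<n wᵢ≡c with i <? m * p
    ... | yes i<mp = i , i<mp , wᵢ≡c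
    ... | no i≮mp =
      let i′ , i′<i , wᵢ′≡c = earlier-occurrence p>0 (≮⇒≥ i≮mp) i<n wᵢ≡c
      in earlier i′<i (<-trans i′<i i<n) wᵢ′≡c

  module _ {q : ℕ} {g : P ↔ P} (perq : Periodic ((m + 2) * p) w q g) (q<p : q < p)
           (mp+2p≤n : (m + 2) * p ≤ n) where

    private
      Commuting : Maybe (S ⊎ P) → Set
      Commuting x =
        Maybe.map (actLetter f) (Maybe.map (actLetter g) x) ≡ Maybe.map (actLetter g) (Maybe.map (actLetter f) x)
      p>0 : 0 < p
      p>0 = ≤-<-trans z≤n q<p
      mp+2p≡ : (m + 2) * p ≡ p + (p + m * p)
      mp+2p≡ = cong (_* p) (+-comm m 2)
      beyond-window : ∀ {i} → (m + 2) * p ≤ q + i → p ≤ i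
      beyond-window {i} mp+2p≤q+i = <⇒≤ (+-cancelˡ-< p p i (begin-strict
        p + p           ≤⟨ +-monoʳ-≤ p (m≤m+n p (m * p)) ⟩
        p + (p + m * p) ≡⟨ mp+2p≡ ⟨
        (m + 2) * p     ≤⟨ mp+2p≤q+i ⟩
        q + i           <⟨ +-monoˡ-< i q<p ⟩
        p + i           ∎))
        where open ≤-Reasoning

    commute-below : ∀ {i} → i < m * p → Commuting (at w i)
    commute-below {i} i<mp = begin
      Maybe.map (actLetter f) (Maybe.map (actLetter g) (at w i)) ≡⟨ cong (Maybe.map (actLetter f)) (perq i q+i<) ⟨
      Maybe.map (actLetter f) (at w (q + i))                     ≡⟨ per (q + i) p+[q+i]<n ⟨
      at w (p + (q + i))                                         ≡⟨ cong (at w) (x∙yz≈y∙xz p q i) ⟩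
      at w (q + (p + i))                                         ≡⟨ perq (p + i) q+[p+i]< ⟩
      Maybe.map (actLetter g) (at w (p + i))                     ≡⟨ cong (Maybe.map (actLetter g)) (per i p+i<n) ⟩
      Maybe.map (actLetter g) (Maybe.map (actLetter f) (at w i)) ∎
      where
      open ≡-Reasoning
      q+[p+i]< : q + (p + i) < (m + 2) * p
      q+[p+i]< = subst (q + (p + i) <_) (sym mp+2p≡) (+-mono-< q<p (+-monoʳ-< p i<mp))
      q+i< : q + i < (m + 2) * p
      q+i< = ≤-<-trans (+-monoʳ-≤ q (m≤n+m i p)) q+[p+i]<
      p+[q+i]<n : p + (q + i) < n
      p+[q+i]<n = <-≤-trans (subst (_< (m + 2) * p) (x∙yz≈y∙xz q p i) q+[p+i]<) mp+2p≤n
      p+i<n : p + i < n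
      p+i<n = <-≤-trans (≤-<-trans (m≤n+m (p + i) q) q+[p+i]<) mp+2p≤n

    commute : ∀ {j} → j < n → Commuting (at w j)
    commute {j} j<n with at w j in wⱼ
    ... | nothing       = refl
    ... | just (inj₁ a) = refl
    ... | just (inj₂ c) =
      let i , i<mp , wᵢ≡c = occurs-below p>0 j j<n wⱼ
      in subst Commuting wᵢ≡c (commute-below i<mp)

    period-extends : Periodic n w q g
    period-extends = <-rec Extends step
      where
      open ≡-Reasoning
      Extends : ℕ → Set
      Extends i = q + i < n → at w (q + i) ≡ Maybe.map (actLetter g) (at w i)
      step : ∀ i → (∀ {j} → j < i → Extends j) → Extends i
      step i earlier q+i<n with q + i <? (m + 2) * p
      ... | yes q+i< = perq i q+i<
      ... | no q+i≮ with j , refl ← m≤n⇒∃[o]m+o≡n (beyond-window (≮⇒≥ q+i≮)) = begin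
        at w (q + (p + j))                                         ≡⟨ cong (at w) (x∙yz≈y∙xz q p j) ⟩
        at w (p + (q + j))                                         ≡⟨ per (q + j) p+[q+j]<n ⟩
        Maybe.map (actLetter f) (at w (q + j))                     ≡⟨ cong (Maybe.map (actLetter f)) (earlier (m<n+m j p>0) q+j<n) ⟩
        Maybe.map (actLetter f) (Maybe.map (actLetter g) (at w j)) ≡⟨ commute (≤-<-trans (m≤n+m j p) p+j<n) ⟩
        Maybe.map (actLetter g) (Maybe.map (actLetter f) (at w j)) ≡⟨ cong (Maybe.map (actLetter g)) (per j p+j<n) ⟨
        Maybe.map (actLetter g) (at w (p + j))                     ∎
        where
        p+[q+j]<n : p + (q + j) < n
        p+[q+j]<n = subst (_< n) (x∙yz≈y∙xz q p j) q+i<n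
        q+j<n : q + j < n
        q+j<n = ≤-<-trans (m≤n+m (q + j) p) p+[q+j]<n
        p+j<n : p + j < n
        p+j<n = ≤-<-trans (m≤n+m (p + j) q) q+i<n

period-of-short-prefix : ∀ {S P : Set} (_≟_ : DecidableEquality P) {w : PString S P} {n p} →
                         n ≤ length w → (numParams _≟_ w + 2) * p ≤ n →
                         PeriodIs (take n w) p → PeriodIs (take ((numParams _≟_ w + 2) * p) w) p
period-of-short-prefix {P = P} _≟_ {w} {n} {p} n≤len kp≤n (_ , isPeriod-p , p-minimal) =
  nonempty , restricted , minimal
  where
  kp : ℕ
  kp = (numParams _≟_ w + 2) * p
  kp≤len : kp ≤ length w
  kp≤len = ≤-trans kp≤n n≤len
  p>0 : 0 < p
  p>0 = proj₁ isPeriod-p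
  p≤kp : p ≤ kp
  p≤kp = subst (p ≤_) (cong (_* p) (+-comm 2 (numParams _≟_ w))) (m≤m+n p _)
  f : P ↔ P
  f = proj₁ (isPeriod-take⇒periodic n≤len isPeriod-p)
  per : Periodic n w p f
  per = proj₂ (isPeriod-take⇒periodic n≤len isPeriod-p)
  nonempty : 0 < length (take kp w)
  nonempty = subst (0 <_) (sym (length-take-≤ kp w kp≤len)) (<-≤-trans p>0 p≤kp)
  restricted : IsPeriod (take kp w) p
  restricted = periodic⇒isPeriod-take kp≤len p>0 p≤kp (λ i p+i<kp → per i (<-≤-trans p+i<kp kp≤n))
  minimal : ∀ q → IsPeriod (take kp w) q → p ≤ q
  minimal q isPeriod-q with p ≤? q
  ... | yes p≤q = p≤q
  ... | no p≰q = contradiction (p-minimal q (periodic⇒isPeriod-take n≤len q>0 q≤n extended)) p≰q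
    where
    q<p : q < p
    q<p = ≰⇒> p≰q
    q>0 : 0 < q
    q>0 = proj₁ isPeriod-q
    q≤n : q ≤ n
    q≤n = ≤-trans (<⇒≤ q<p) (≤-trans p≤kp kp≤n)
    extended : Periodic n w q (proj₁ (isPeriod-take⇒periodic kp≤len isPeriod-q))
    extended = period-extends _≟_ {w = w} per (proj₂ (isPeriod-take⇒periodic kp≤len isPeriod-q)) q<p kp≤n

lemma8 : {S P : Set} (_≟_ : DecidableEquality P) (w : PString S P) →
    1 ≤ numParams _≟_ w →
    (p : ℕ) → 0 < p → (numParams _≟_ w + 2) * p ≤ length w →
    (IsPrefixPeriod _≟_ w p → PeriodIs (take ((numParams _≟_ w + 2) * p) w) p) ×
    (PeriodIs (take ((numParams _≟_ w + 2) * p) w) p → IsPrefixPeriod _≟_ w p)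
lemma8 _≟_ w _ p _ kp≤len = from-prefix-period , to-prefix-period
  where
  kp : ℕ
  kp = (numParams _≟_ w + 2) * p
  from-prefix-period : IsPrefixPeriod _≟_ w p → PeriodIs (take kp w) p
  from-prefix-period (n , n≤len , period-p , kp≤prefix) =
    period-of-short-prefix _≟_ n≤len (subst (kp ≤_) (length-take-≤ n w n≤len) kp≤prefix) period-p
  to-prefix-period : PeriodIs (take kp w) p → IsPrefixPeriod _≟_ w p
  to-prefix-period period-p = kp , kp≤len , period-p , ≤-reflexive (sym (length-take-≤ kp w kp≤len))
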